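{- Let $V\subset\mathbb{R}^d$ be a finite antichain, let $p\in S_V$, let $i\in\{1,\dots,d\}$ and let $F$ be an $i$-flat of $S_V$. Then $p\in F$ if and only if there exist $v\in V_F$ and $q\in S_V$ such that $q\rhd_i v$ and $v\le p\le q$.
   Context: $\mathbb{R}^d$ carries the dominance order ($x\le y$ iff $x_k\le y_k$ for all $k$). Write $x\rhd y$ if $x_k>y_k$ for all $k$, and $x\rhd_i y$ if $x_i=y_i$ and $x_j>y_j$ for all $j\neq i$. For a finite antichain $V$ (elements called minima), $S_V$ is the topological boundary of $\{x: x\ge v\text{ for some }v\in V\}$; equivalently $p\in S_V$ iff $p\ge v$ for some $v\in V$ and no $w\in V$ satisfies $p\rhd w$. For $v\in V$ put $U_i(v)=\{p\in S_V: p\rhd_i v\}$. Define $v\sim_i w$ iff $U_i(v)\cap U_i(w)\neq\emptyset$, and let $\sim_i^c$ be the reflexive–transitive closure of $\sim_i$ (an equivalence relation on $V$). The $i$-flat of $v$ is $F_i(v)=$ the topological closure of $\bigcup_{w\sim_i^c v}U_i(w)$; an $i$-flat is any set of the form $F_i(v)$. For an $i$-flat $F$, $V_F=\{w\in V: F_i(w)=F\}$ is the equivalence class of minima on $F$. -}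

module Defs where

open import Level using (0ℓ)
open import Data.Nat using (ℕ)
open import Data.Fin using (Fin)
open import Data.Product using (Σ; ∃; _×_; _,_)
open import Data.Sum using (_⊎_)
open import Relation.Nullary using (¬_)
open import Relation.Binary.PropositionalEquality using (_≡_; _≢_)
open import Relation.Binary.Structures using (IsStrictTotalOrder)
open import Relation.Binary.Construct.Closure.ReflexiveTransitive using (Star)
open import Algebra.Structures using (IsCommutativeRing)

-- The real numbers, axiomatised as a complete ordered field.
-- (agda-stdlib has no reals; any model of this record is isomorphic
-- to ℝ, and the theorem is stated for every such model.)

record RealField : Set₁ where
  infixl 6 _+_
  infixl 7 _*_
  infix  4 _<_ _≤_
  field
    Carrier : Set
    _+_ _*_ : Carrier → Carrier → Carrier
    -_      : Carrier → Carrier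
    0# 1#   : Carrier
    _<_     : Carrier → Carrier → Set
    isCommutativeRing : IsCommutativeRing _≡_ _+_ _*_ -_ 0# 1#
    isStrictTotalOrder : IsStrictTotalOrder _≡_ _<_
    0≢1     : 0# ≢ 1#
    inverse : ∀ x → x ≢ 0# → ∃ λ y → x * y ≡ 1#
    +-mono-< : ∀ {x y} z → x < y → x + z < y + z
    *-pos    : ∀ {x y} → 0# < x → 0# < y → 0# < x * y

  _≤_ : Carrier → Carrier → Set
  x ≤ y = x < y ⊎ x ≡ y

  field
    complete : (P : Carrier → Set) → (∃ P) →
               (∃ λ b → ∀ x → P x → x ≤ b) →
               ∃ λ s → (∀ x → P x → x ≤ s) ×
                       (∀ b → (∀ x → P x → x ≤ b) → s ≤ b)

module Geometry (R : RealField) (d : ℕ) where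
  open RealField R

  Point : Set
  Point = Fin d → Carrier

  _≤ᵈ_ : Point → Point → Set
  x ≤ᵈ y = ∀ k → x k ≤ y k

  _▷_ : Point → Point → Set
  x ▷ y = ∀ k → y k < x k

  _▷[_]_ : Point → Fin d → Point → Set
  x ▷[ i ] y = (x i ≡ y i) × (∀ j → j ≢ i → y j < x j)

  Subset : Set₁
  Subset = Point → Set

  -- topological closure in ℝ^d (sup-metric, which induces the usual topology)
  closure : Subset → Subset
  closure A p = ∀ ε → 0# < ε →
    ∃ λ q → A q × (∀ k → (p k < q k + ε) × (q k < p k + ε))

  IsAntichain : {n : ℕ} → (Fin n → Point) → Set
  IsAntichain V = ∀ a b → V a ≤ᵈ V b → a ≡ b

  module Surface {n : ℕ} (V : Fin n → Point) where

    S : Subset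
    S p = (∃ λ a → V a ≤ᵈ p) × ¬ (∃ λ b → p ▷ V b)

    U : Fin d → Fin n → Subset
    U i a p = S p × (p ▷[ i ] V a)

    _∼[_]_ : Fin n → Fin d → Fin n → Set
    a ∼[ i ] b = ∃ λ p → U i a p × U i b p

    _∼[_]ᶜ_ : Fin n → Fin d → Fin n → Set
    a ∼[ i ]ᶜ b = Star (λ x y → x ∼[ i ] y) a b

    Flat : Fin d → Fin n → Subset
    Flat i a = closure (λ p → ∃ λ b → (b ∼[ i ]ᶜ a) × U i b p)

    _≐_ : Subset → Subset → Set
    A ≐ B = ∀ p → (A p → B p) × (B p → A p)

    InVF : Fin d → Subset → Fin n → Set
    InVF i F b = Flat i b ≐ F

-- (⇐) Raising p, in the coordinates j ≠ i where it touches v, strictly but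
-- arbitrarily little while staying below q, gives points p′ ≥ v with
-- p′ ▷ᵢ v; they lie on S_V because p′ ≤ q, so p is a limit of points of U_i(v).
-- (⇒) Take ε below every nonzero gap |p_k − w_k| between p and the minima w.
-- A point q′ ∈ U_i(c) (c ∼ᵢᶜ a) that is ε-close to p cannot differ from p
-- across any such gap, so c ≤ p and p_i = c_i, and max(p, q′) is a point of
-- S_V lying ▷ᵢ c.
module Submission where

open import Defs
open import Level using (0ℓ)
open import Data.Nat using (ℕ; zero; suc)
open import Data.Fin using (Fin; zero; suc; _≟_)
open import Data.Product using (∃; _×_; _,_; proj₁; proj₂)
open import Data.Sum using (inj₁; inj₂)
open import Relation.Nullary using (¬_; yes; no; contradiction)
open import Relation.Binary.PropositionalEquality
open import Relation.Binary.Definitions using (tri<; tri≈; tri>)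
open import Relation.Binary.Bundles using (StrictTotalOrder; DecTotalOrder)
open import Relation.Binary.Structures using (IsStrictTotalOrder)
open import Algebra.Bundles using (CommutativeRing)
import Algebra.Properties.Ring as RingProperties
import Relation.Binary.Properties.StrictTotalOrder as StrictTotalOrderProperties
import Algebra.Construct.NaturalChoice.Max as Max
import Algebra.Construct.NaturalChoice.Min as Min
open import Relation.Binary.Construct.Closure.ReflexiveTransitive as Star using (_◅◅_; reverse)
open import Function using (_∘_)
open import Function.Bundles using (_⇔_; mk⇔)

module OrderedField (R : RealField) where
  open RealField R
  open ≡-Reasoning

  private
    sto : StrictTotalOrder 0ℓ 0ℓ 0ℓ
    sto = record { isStrictTotalOrder = isStrictTotalOrder }
    ring : CommutativeRing 0ℓ 0ℓ
    ring = record { isCommutativeRing = isCommutativeRing }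

  open CommutativeRing ring
    using (+-assoc; +-comm; +-identityˡ; +-identityʳ; -‿inverseˡ; -‿inverseʳ; *-identityˡ; distribʳ; zeroʳ)
  open RingProperties (CommutativeRing.ring ring) using (-‿involutive; -1*x≈-x; -‿distribʳ-*)
  open IsStrictTotalOrder isStrictTotalOrder public using (compare)
    renaming (trans to <-trans; asym to <-asym)
  module ≤ = DecTotalOrder (StrictTotalOrderProperties.decTotalOrder sto)
  open Max ≤.totalOrder public using (_⊔_; x≤x⊔y; x≤y⊔x; ⊔-sel; ⊔-idem; ⊔-lub)
  open Min ≤.totalOrder public using (_⊓_; x⊓y≤x; x⊓y≤y; ⊓-sel)

  <-≤-trans : ∀ {x y z} → x < y → y ≤ z → x < z
  <-≤-trans x<y (inj₁ y<z) = <-trans x<y y<z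
  <-≤-trans x<y (inj₂ refl) = x<y

  ≤-<-trans : ∀ {x y z} → x ≤ y → y < z → x < z
  ≤-<-trans (inj₁ x<y) y<z = <-trans x<y y<z
  ≤-<-trans (inj₂ refl) y<z = y<z

  <-irrefl : ∀ {x} → ¬ (x < x)
  <-irrefl = IsStrictTotalOrder.irrefl isStrictTotalOrder refl

  ≮⇒≥ : ∀ {x y} → ¬ (x < y) → y ≤ x
  ≮⇒≥ {x} {y} x≮y with compare x y
  ... | tri< x<y _ _ = contradiction x<y x≮y
  ... | tri≈ _ x≡y _ = inj₂ (sym x≡y)
  ... | tri> _ _ y<x = inj₁ y<x

  +-monoʳ-< : ∀ z {x y} → x < y → z + x < z + y
  +-monoʳ-< z {x} {y} x<y = subst₂ _<_ (+-comm x z) (+-comm y z) (+-mono-< z x<y)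

  +-monoʳ-≤ : ∀ z {x y} → x ≤ y → z + x ≤ z + y
  +-monoʳ-≤ z (inj₁ x<y) = inj₁ (+-monoʳ-< z x<y)
  +-monoʳ-≤ z (inj₂ refl) = ≤.refl

  x+y-y≡x : ∀ x y → x + y + - y ≡ x
  x+y-y≡x x y = begin
    x + y + - y   ≡⟨ +-assoc x y (- y) ⟩
    x + (y + - y) ≡⟨ cong (x +_) (-‿inverseʳ y) ⟩
    x + 0#        ≡⟨ +-identityʳ x ⟩
    x             ∎

  x+[y-x]≡y : ∀ x y → x + (y + - x) ≡ y
  x+[y-x]≡y x y = begin
    x + (y + - x) ≡⟨ +-comm x (y + - x) ⟩
    y + - x + x   ≡⟨ +-assoc y (- x) x ⟩
    y + (- x + x) ≡⟨ cong (y +_) (-‿inverseˡ x) ⟩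
    y + 0#        ≡⟨ +-identityʳ y ⟩
    y             ∎

  +-cancelʳ-< : ∀ z {x y} → x + z < y + z → x < y
  +-cancelʳ-< z {x} {y} lt = subst₂ _<_ (x+y-y≡x x z) (x+y-y≡x y z) (+-mono-< (- z) lt)

  x<x+ε : ∀ x {ε} → 0# < ε → x < x + ε
  x<x+ε x {ε} 0<ε = subst (_< x + ε) (+-identityʳ x) (+-monoʳ-< x 0<ε)

  x<y⇒0<y-x : ∀ {x y} → x < y → 0# < y + - x
  x<y⇒0<y-x {x} {y} x<y = subst (_< y + - x) (-‿inverseʳ x) (+-mono-< (- x) x<y)

  x<0⇒0<-x : ∀ {x} → x < 0# → 0# < - x
  x<0⇒0<-x {x} x<0 = subst (0# <_) (+-identityˡ (- x)) (x<y⇒0<y-x x<0)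

  0<x⇒-x<0 : ∀ {x} → 0# < x → - x < 0#
  0<x⇒-x<0 {x} 0<x = subst₂ _<_ (+-identityˡ (- x)) (-‿inverseʳ x) (+-mono-< (- x) 0<x)

  0<1 : 0# < 1#
  0<1 with compare 0# 1#
  ... | tri< 0<1 _ _ = 0<1
  ... | tri≈ _ 0≡1 _ = contradiction 0≡1 0≢1
  ... | tri> _ _ 1<0 = contradiction 0<[-1]² (<-asym 1<0)
    where
    0<[-1]² : 0# < 1#
    0<[-1]² = subst (0# <_) (trans (-1*x≈-x (- 1#)) (-‿involutive 1#))
                (*-pos (x<0⇒0<-x 1<0) (x<0⇒0<-x 1<0))

  0<x∧0<xy⇒0<y : ∀ {x y} → 0# < x → 0# < x * y → 0# < y
  0<x∧0<xy⇒0<y {x} {y} 0<x 0<xy with compare 0# y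
  ... | tri< 0<y _ _ = 0<y
  ... | tri≈ _ refl _ = contradiction (subst (0# <_) (zeroʳ x) 0<xy) <-irrefl
  ... | tri> _ _ y<0 = contradiction (0<x⇒-x<0 0<xy) (<-asym 0<-[xy])
    where
    0<-[xy] : 0# < - (x * y)
    0<-[xy] = subst (0# <_) (sym (-‿distribʳ-* x y)) (*-pos 0<x (x<0⇒0<-x y<0))

  0<2 : 0# < 1# + 1#
  0<2 = <-trans 0<1 (x<x+ε 1# 0<1)

  half : ∃ λ h → 0# < h × h + h ≡ 1#
  half with inverse (1# + 1#) (λ 2≡0 → <-irrefl (subst (0# <_) 2≡0 0<2))
  ... | h , 2h≡1 = h , 0<h , h+h≡1
    where
    h+h≡1 : h + h ≡ 1#
    h+h≡1 = begin
      h + h             ≡⟨ cong₂ _+_ (*-identityˡ h) (*-identityˡ h) ⟨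
      1# * h + 1# * h   ≡⟨ distribʳ h 1# 1# ⟨
      (1# + 1#) * h     ≡⟨ 2h≡1 ⟩
      1#                ∎
    0<h : 0# < h
    0<h = 0<x∧0<xy⇒0<y 0<2 (subst (0# <_) (sym 2h≡1) 0<1)

  density : ∀ {x y} → x < y → ∃ λ z → x < z × z < y
  density {x} {y} x<y with half
  ... | h , 0<h , h+h≡1 = x + δ , x<x+ε x 0<δ , subst (x + δ <_) x+δ+δ≡y (x<x+ε (x + δ) 0<δ)
    where
    δ : Carrier
    δ = h * (y + - x)
    0<δ : 0# < δ
    0<δ = *-pos 0<h (x<y⇒0<y-x x<y)
    x+δ+δ≡y : x + δ + δ ≡ y
    x+δ+δ≡y = begin
      x + δ + δ                 ≡⟨ +-assoc x δ δ ⟩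
      x + (δ + δ)               ≡⟨ cong (x +_) (distribʳ (y + - x) h h) ⟨
      x + (h + h) * (y + - x)   ≡⟨ cong (λ t → x + t * (y + - x)) h+h≡1 ⟩
      x + 1# * (y + - x)        ≡⟨ cong (x +_) (*-identityˡ (y + - x)) ⟩
      x + (y + - x)             ≡⟨ x+[y-x]≡y x y ⟩
      y                         ∎

  Separated : Carrier → Carrier → Carrier → Set
  Separated ε x y = (x < y → x + ε ≤ y) × (y < x → y + ε ≤ x)

  separated-sym : ∀ {ε x y} → Separated ε x y → Separated ε y x
  separated-sym (x<y⇒ , y<x⇒) = y<x⇒ , x<y⇒

  separated-≤ : ∀ {ε ε′ x y} → ε′ ≤ ε → Separated ε x y → Separated ε′ x y
  separated-≤ {x = x} {y} ε′≤ε (x<y⇒ , y<x⇒) =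
    (λ x<y → ≤.trans (+-monoʳ-≤ x ε′≤ε) (x<y⇒ x<y)) ,
    (λ y<x → ≤.trans (+-monoʳ-≤ y ε′≤ε) (y<x⇒ y<x))

  separated-positive : ∀ x y → ∃ λ ε → 0# < ε × Separated ε x y
  separated-positive x y with compare x y
  ... | tri< x<y _ y≮x = y + - x , x<y⇒0<y-x x<y , (λ _ → inj₂ (x+[y-x]≡y x y)) , λ y<x → contradiction y<x y≮x
  ... | tri≈ x≮y _ y≮x = 1# , 0<1 , (λ x<y → contradiction x<y x≮y) , λ y<x → contradiction y<x y≮x
  ... | tri> x≮y _ y<x = x + - y , x<y⇒0<y-x y<x , (λ x<y → contradiction x<y x≮y) , λ _ → inj₂ (x+[y-x]≡y y x)

  separated-close : ∀ {ε x y} → Separated ε x y → y < x + ε → y ≤ x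
  separated-close (x<y⇒ , _) y<x+ε = ≮⇒≥ λ x<y → <-irrefl (≤-<-trans (x<y⇒ x<y) y<x+ε)

  0<x⊓y : ∀ {x y} → 0# < x → 0# < y → 0# < x ⊓ y
  0<x⊓y {x} {y} 0<x 0<y with ⊓-sel x y
  ... | inj₁ x⊓y≡x = subst (0# <_) (sym x⊓y≡x) 0<x
  ... | inj₂ x⊓y≡y = subst (0# <_) (sym x⊓y≡y) 0<y

  uniform-radius : ∀ m (P : Fin m → Carrier → Set) →
    (∀ k {ε ε′} → ε′ ≤ ε → P k ε → P k ε′) →
    (∀ k → ∃ λ ε → 0# < ε × P k ε) →
    ∃ λ ε → 0# < ε × ∀ k → P k ε
  uniform-radius zero P _ _ = 1# , 0<1 , λ ()
  uniform-radius (suc m) P P-antitone radius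
    with radius zero | uniform-radius m (λ k → P (suc k)) (λ k → P-antitone (suc k)) (λ k → radius (suc k))
  ... | ε₀ , 0<ε₀ , P₀ | ε , 0<ε , P-rest = ε₀ ⊓ ε , 0<x⊓y 0<ε₀ 0<ε , λ
    { zero → P-antitone zero (x⊓y≤x ε₀ ε) P₀
    ; (suc k) → P-antitone (suc k) (x⊓y≤y ε₀ ε) (P-rest k) }

  <-⊓ : ∀ {x y z} → x < y → x < z → x < y ⊓ z
  <-⊓ {x} {y} {z} x<y x<z with ⊓-sel y z
  ... | inj₁ y⊓z≡y = subst (x <_) (sym y⊓z≡y) x<y
  ... | inj₂ y⊓z≡z = subst (x <_) (sym y⊓z≡z) x<z

  ⊔-< : ∀ {x y z} → x < z → y < z → x ⊔ y < z
  ⊔-< {x} {y} {z} x<z y<z with ⊔-sel x y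
  ... | inj₁ x⊔y≡x = subst (_< z) (sym x⊔y≡x) x<z
  ... | inj₂ x⊔y≡y = subst (_< z) (sym x⊔y≡y) y<z

  <-⊔-close : ∀ {ε x y z} → Separated ε x z → z < x ⊔ y → x < y + ε → z < y
  <-⊔-close {ε} {x} {y} {z} (_ , z<x⇒) z<x⊔y x<y+ε with ⊔-sel x y
  ... | inj₁ x⊔y≡x = +-cancelʳ-< ε (≤-<-trans (z<x⇒ (subst (z <_) x⊔y≡x z<x⊔y)) x<y+ε)
  ... | inj₂ x⊔y≡y = subst (z <_) x⊔y≡y z<x⊔y

  raise-above : ∀ {ε w x y} → 0# < ε → w ≤ x → x ≤ y → w < y →
    ∃ λ z → x ≤ z × z ≤ y × z < x + ε × w < z
  raise-above {ε} {x = x} {y} 0<ε w≤x x≤y w<y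
    with density (<-⊓ w<y (≤-<-trans w≤x (x<x+ε x 0<ε)))
  ... | z , w<z , z<y⊓x+ε =
    x ⊔ z , x≤x⊔y x z , ⊔-lub x≤y (inj₁ (<-≤-trans z<y⊓x+ε (x⊓y≤x y (x + ε)))) ,
    ⊔-< (x<x+ε x 0<ε) (<-≤-trans z<y⊓x+ε (x⊓y≤y y (x + ε))) , <-≤-trans w<z (x≤y⊔x x z)

module PointOrder (R : RealField) (d : ℕ) where
  open RealField R
  open OrderedField R
  open Geometry R d

  ≤ᵈ-trans : ∀ {x y z} → x ≤ᵈ y → y ≤ᵈ z → x ≤ᵈ z
  ≤ᵈ-trans x≤y y≤z k = ≤.trans (x≤y k) (y≤z k)

  ▷ᵢ⇒≥ᵈ : ∀ {x y i} → x ▷[ i ] y → y ≤ᵈ x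
  ▷ᵢ⇒≥ᵈ {i = i} (xᵢ≡yᵢ , x▷y) k with k ≟ i
  ... | yes refl = inj₂ (sym xᵢ≡yᵢ)
  ... | no k≢i = inj₁ (x▷y k k≢i)

  _⊔ᵈ_ : Point → Point → Point
  (x ⊔ᵈ y) k = x k ⊔ y k

  Near : Carrier → Point → Point → Set
  Near ε x y = ∀ k → (x k < y k + ε) × (y k < x k + ε)

  ▷ᵢ-approximation : ∀ {ε v i p q} → 0# < ε → v ≤ᵈ p → p ≤ᵈ q → q ▷[ i ] v →
    ∃ λ p′ → p ≤ᵈ p′ × p′ ≤ᵈ q × p′ ▷[ i ] v × Near ε p p′
  ▷ᵢ-approximation {ε} {v} {i} {p} {q} 0<ε v≤p p≤q (qᵢ≡vᵢ , q▷v) =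
    p′ , p≤p′ , p′≤q , (p′ᵢ≡vᵢ , v<p′) , λ k → ≤-<-trans (p≤p′ k) (x<x+ε (p′ k) 0<ε) , p′<p+ε k
    where
    raised : ∀ k → k ≢ i → ∃ λ z → p k ≤ z × z ≤ q k × z < p k + ε × v k < z
    raised k k≢i = raise-above 0<ε (v≤p k) (p≤q k) (q▷v k k≢i)

    p′ : Point
    p′ k with k ≟ i
    ... | yes _ = p k
    ... | no k≢i = proj₁ (raised k k≢i)

    p≤p′ : p ≤ᵈ p′
    p≤p′ k with k ≟ i
    ... | yes _ = ≤.refl
    ... | no k≢i = proj₁ (proj₂ (raised k k≢i))

    p′≤q : p′ ≤ᵈ q
    p′≤q k with k ≟ i
    ... | yes _ = p≤q k
    ... | no k≢i = proj₁ (proj₂ (proj₂ (raised k k≢i)))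

    p′<p+ε : ∀ k → p′ k < p k + ε
    p′<p+ε k with k ≟ i
    ... | yes _ = x<x+ε (p k) 0<ε
    ... | no k≢i = proj₁ (proj₂ (proj₂ (proj₂ (raised k k≢i))))

    p′ᵢ≡vᵢ : p′ i ≡ v i
    p′ᵢ≡vᵢ with i ≟ i
    ... | yes _ = ≤.antisym (≤.trans (p≤q i) (inj₂ qᵢ≡vᵢ)) (v≤p i)
    ... | no i≢i = contradiction refl i≢i

    v<p′ : ∀ j → j ≢ i → v j < p′ j
    v<p′ j j≢i with j ≟ i
    ... | yes j≡i = contradiction j≡i j≢i
    ... | no j≢i = proj₂ (proj₂ (proj₂ (proj₂ (raised j j≢i))))

module Flats (R : RealField) (d n : ℕ) (V : Fin n → Geometry.Point R d) where
  open RealField R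
  open OrderedField R
  open Geometry R d
  open PointOrder R d
  open Surface V

  ≐-sym : ∀ {A B} → A ≐ B → B ≐ A
  ≐-sym A≐B p = proj₂ (A≐B p) , proj₁ (A≐B p)

  ≐-trans : ∀ {A B C} → A ≐ B → B ≐ C → A ≐ C
  ≐-trans A≐B B≐C p = proj₁ (B≐C p) ∘ proj₁ (A≐B p) , proj₂ (A≐B p) ∘ proj₂ (B≐C p)

  ∼-sym : ∀ {i a b} → a ∼[ i ] b → b ∼[ i ] a
  ∼-sym (p , Uᵢa , Uᵢb) = p , Uᵢb , Uᵢa

  Flat-⊆ : ∀ {i a b} → a ∼[ i ]ᶜ b → ∀ p → Flat i a p → Flat i b p
  Flat-⊆ a∼b p Fᵢa ε 0<ε with Fᵢa ε 0<ε
  ... | q , (c , c∼a , Uᵢc) , p≈q = q , (c , c∼a ◅◅ a∼b , Uᵢc) , p≈q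

  Flat-cong : ∀ {i a b} → a ∼[ i ]ᶜ b → Flat i a ≐ Flat i b
  Flat-cong a∼b p = Flat-⊆ a∼b p , Flat-⊆ (reverse ∼-sym a∼b) p

  S-between : ∀ {a p q} → S q → V a ≤ᵈ p → p ≤ᵈ q → S p
  S-between (_ , q⋫V) Va≤p p≤q = (_ , Va≤p) , λ (w , p▷Vw) → q⋫V (w , λ k → <-≤-trans (p▷Vw k) (p≤q k))

  separation-radius : (p : Point) → ∃ λ ε → 0# < ε × ∀ w k → Separated ε (p k) (V w k)
  separation-radius p = uniform-radius n (λ w ε → ∀ k → Separated ε (p k) (V w k))
    (λ _ ε′≤ε sep k → separated-≤ ε′≤ε (sep k))
    (λ w → uniform-radius d (λ k ε → Separated ε (p k) (V w k))
      (λ _ → separated-≤) (λ k → separated-positive (p k) (V w k)))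

  module _ {ε p q′} (sep : ∀ w k → Separated ε (p k) (V w k)) (p≈q′ : Near ε p q′) where

    ≤ᵈ-near : ∀ {w} → V w ≤ᵈ q′ → V w ≤ᵈ p
    ≤ᵈ-near {w} Vw≤q′ k = separated-close (sep w k) (≤-<-trans (Vw≤q′ k) (proj₂ (p≈q′ k)))

    S-⊔ᵈ-near : ∀ {c} → S q′ → V c ≤ᵈ p → S (p ⊔ᵈ q′)
    S-⊔ᵈ-near (_ , q′⋫V) Vc≤p =
      (_ , ≤ᵈ-trans Vc≤p (λ k → x≤x⊔y (p k) (q′ k))) ,
      λ (w , p⊔q′▷Vw) → q′⋫V (w , λ k → <-⊔-close (sep w k) (p⊔q′▷Vw k) (proj₁ (p≈q′ k)))

    surface-point-above : ∀ {c i} → S q′ → q′ ▷[ i ] V c →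
      ∃ λ q → S q × (q ▷[ i ] V c) × (V c ≤ᵈ p) × (p ≤ᵈ q)
    surface-point-above {c} {i} Sq′ (q′ᵢ≡Vcᵢ , q′▷Vc) =
      p ⊔ᵈ q′ , S-⊔ᵈ-near Sq′ Vc≤p , (⊔ᵢ≡Vcᵢ , ⊔▷Vc) , Vc≤p , λ k → x≤x⊔y (p k) (q′ k)
      where
      Vc≤p : V c ≤ᵈ p
      Vc≤p = ≤ᵈ-near (▷ᵢ⇒≥ᵈ (q′ᵢ≡Vcᵢ , q′▷Vc))
      pᵢ≡Vcᵢ : p i ≡ V c i
      pᵢ≡Vcᵢ = ≤.antisym
        (separated-close (separated-sym (sep c i)) (subst (λ t → p i < t + ε) q′ᵢ≡Vcᵢ (proj₁ (p≈q′ i))))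
        (Vc≤p i)
      ⊔ᵢ≡Vcᵢ : p i ⊔ q′ i ≡ V c i
      ⊔ᵢ≡Vcᵢ = begin
        p i ⊔ q′ i     ≡⟨ cong₂ _⊔_ pᵢ≡Vcᵢ q′ᵢ≡Vcᵢ ⟩
        V c i ⊔ V c i  ≡⟨ ⊔-idem (V c i) ⟩
        V c i          ∎
        where open ≡-Reasoning
      ⊔▷Vc : ∀ j → j ≢ i → V c j < p j ⊔ q′ j
      ⊔▷Vc j j≢i = <-≤-trans (q′▷Vc j j≢i) (x≤y⊔x (p j) (q′ j))

  flat-point-witness : ∀ {p i a} → Flat i a p →
    ∃ λ c → (c ∼[ i ]ᶜ a) × ∃ λ q → S q × (q ▷[ i ] V c) × (V c ≤ᵈ p) × (p ≤ᵈ q)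
  flat-point-witness {p} Fᵢap with separation-radius p
  ... | ε , 0<ε , sep with Fᵢap ε 0<ε
  ... | q′ , (c , c∼a , Sq′ , q′▷ᵢVc) , p≈q′ = c , c∼a , surface-point-above sep p≈q′ Sq′ q′▷ᵢVc

  below-surface-in-flat : ∀ {b i p q} → S q → q ▷[ i ] V b → V b ≤ᵈ p → p ≤ᵈ q → Flat i b p
  below-surface-in-flat Sq q▷ᵢVb Vb≤p p≤q ε 0<ε
    with ▷ᵢ-approximation 0<ε Vb≤p p≤q q▷ᵢVb
  ... | p′ , p≤p′ , p′≤q , p′▷ᵢVb , p≈p′ =
    p′ , (_ , Star.ε , S-between Sq (≤ᵈ-trans Vb≤p p≤p′) p′≤q , p′▷ᵢVb) , p≈p′

mainTheorem2 : (R : RealField) (d n : ℕ) (V : Fin n → Geometry.Point R d) →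
    Geometry.IsAntichain R d V →
    let open Geometry R d in
    let open Surface V in
    (p : Point) → S p → (i : Fin d) → (F : Subset) → (∃ λ a → F ≐ Flat i a) →
    F p ⇔ (∃ λ b → InVF i F b × ∃ λ q → S q × (q ▷[ i ] V b) × (V b ≤ᵈ p) × (p ≤ᵈ q))
mainTheorem2 R d n V _ p _ i F (a , F≐Flatᵢa) = mk⇔ to from
  where
  open Geometry R d
  open Surface V
  open Flats R d n V
  to : F p → ∃ λ b → InVF i F b × ∃ λ q → S q × (q ▷[ i ] V b) × (V b ≤ᵈ p) × (p ≤ᵈ q)
  to Fp with flat-point-witness (proj₁ (F≐Flatᵢa p) Fp)
  ... | c , c∼a , surface-point = c , ≐-trans (Flat-cong c∼a) (≐-sym F≐Flatᵢa) , surface-point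
  from : (∃ λ b → InVF i F b × ∃ λ q → S q × (q ▷[ i ] V b) × (V b ≤ᵈ p) × (p ≤ᵈ q)) → F p
  from (b , Flatᵢb≐F , q , Sq , q▷ᵢVb , Vb≤p , p≤q) = proj₁ (Flatᵢb≐F p) (below-surface-in-flat Sq q▷ᵢVb Vb≤p p≤q)
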